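{- Let $k,\Delta\geq 2$ with $\Delta\leq k$, and let $T$ be any $[\Delta,k]$-transversal design. Let $a,b\geq 0$ with $a+b=\Delta_0\leq\Delta$. Suppose we are given $a$ nodes of $T$ (the target-nodes) and $b$ blocks of $T$ (the target-blocks), where repetitions are allowed among the target-nodes and among the target-blocks. Suppose $D_0$ is a group of $T$ containing no target-node. Then there exists a set $S$ of $\Delta_0$ distinct nodes of $D_0$ and $\Delta_0$ pairwise internally-disjoint paths in $T$, each of length at most $3$, whose sources are exactly the nodes of $S$ and whose destinations are exactly the target-nodes and target-blocks (with multiplicity).
   Context: A $[\Delta,k]$-transversal design ($k,\Delta\ge2$) is a set of $\Delta k$ elements partitioned into $\Delta$ groups of size $k$, with a family of $k^2$ blocks, each a $\Delta$-subset meeting every group in exactly one element, such that every pair of elements from distinct groups lies in exactly one block. It is viewed as a bipartite graph with the elements as nodes, the blocks as blocks, and a node adjacent to a block iff it belongs to it. A path is a sequence of distinct vertices with consecutive ones adjacent; its length is its number of edges. A set of paths is pairwise internally-disjoint if every source or destination appears only as a source or destination of paths in the set, and every other vertex appears on at most one of the paths. -}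

module Defs where

open import Data.Nat using (ℕ; _*_; _+_; _≤_)
open import Data.Fin using (Fin; splitAt)
open import Data.Product using (_×_; ∃!; proj₁; _,_)
open import Data.Empty using (⊥)
open import Data.Sum using (_⊎_; inj₁; inj₂; [_,_]′)
open import Data.List using (List; []; _∷_; _++_; [_]; length)
open import Data.List.Relation.Unary.Unique.Propositional using (Unique)
open import Data.List.Relation.Unary.Linked using (Linked)
open import Data.List.Membership.Propositional using (_∈_; _∉_)
open import Relation.Binary.PropositionalEquality using (_≡_; _≢_)

-- Elements of a [Δ,k]-transversal design: the element set of size Δk is
-- (without loss of generality) Fin Δ × Fin k, group g = {g} × Fin k.
Node : ℕ → ℕ → Set
Node Δ k = Fin Δ × Fin k

groupOf : ∀ {Δ k} → Node Δ k → Fin Δ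
groupOf = proj₁

-- A [Δ,k]-transversal design: a family of k² blocks, each meeting every group
-- in exactly one element (so a block is a function Fin Δ → Fin k: in group g
-- it contains the element (g , block B g)), such that every pair of elements
-- from distinct groups lies in exactly one block.
record TransversalDesign (Δ k : ℕ) : Set where
  field
    block : Fin (k * k) → Fin Δ → Fin k
    pairUnique : ∀ (g h : Fin Δ) → g ≢ h → ∀ (x y : Fin k) →
                 ∃! _≡_ (λ B → block B g ≡ x × block B h ≡ y)

Block : ℕ → Set
Block k = Fin (k * k)

Vertex : ℕ → ℕ → Set
Vertex Δ k = Node Δ k ⊎ Block k

Adj : ∀ {Δ k} → TransversalDesign Δ k → Vertex Δ k → Vertex Δ k → Set
Adj T (inj₁ (g , x)) (inj₂ B) = TransversalDesign.block T B g ≡ x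
Adj T (inj₂ B) (inj₁ (g , x)) = TransversalDesign.block T B g ≡ x
Adj T (inj₁ _) (inj₁ _) = ⊥
Adj T (inj₂ _) (inj₂ _) = ⊥

pathVertices : ∀ {A : Set} → A → List A → A → List A
pathVertices s mids t = s ∷ (mids ++ [ t ])

IsPath : ∀ {Δ k} → TransversalDesign Δ k → Vertex Δ k → List (Vertex Δ k) → Vertex Δ k → Set
IsPath T s mids t = Unique (pathVertices s mids t) × Linked (Adj T) (pathVertices s mids t)

pathLength : ∀ {A : Set} → List A → ℕ
pathLength mids = length mids + 1

InternallyDisjoint : ∀ {A : Set} {n : ℕ} → (Fin n → A) → (Fin n → List A) → (Fin n → A) → Set
InternallyDisjoint {n = n} src mids dst =
  ∀ (i j : Fin n) (v : _) → v ∈ mids i →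
    (v ≢ src j) × (v ≢ dst j) × (i ≢ j → v ∉ mids j)

targets : ∀ {Δ k a b} → (Fin a → Node Δ k) → (Fin b → Block k) → Fin (a + b) → Vertex Δ k
targets {a = a} tn tb i = [ (λ j → inj₁ (tn j)) , (λ j → inj₂ (tb j)) ]′ (splitAt a i)

module Submission where

-- A target-block B whose D₀-element is not yet
-- taken is reached directly from that element. All other targets get a fresh element s of D₀,
-- i.e. one lying on no target-block: a target-node x is reached via the block through (D₀,s)
-- and x; a target-block B whose D₀-element is already taken is reached via the block through
-- (D₀,s) and the node of B in a relay group, the relay groups being distinct, different from D₀
-- and from the groups of the target-nodes. There are a + b ≤ Δ ≤ k sources in D₀, and the
-- relay groups exist because a repeated target-block forces at least one direct one, so that
-- 1 + a + #repeated ≤ a + b ≤ Δ.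

open import Data.Nat using (ℕ; suc; _+_; _≤_; _<_; s≤s; z≤n)
open import Data.Nat.Properties
  using (≤-trans; ≤-reflexive; <-≤-trans; +-suc; +-comm; +-assoc; m<m+n; +-monoʳ-≤; module ≤-Reasoning)
open import Data.Fin using (Fin; _≟_; splitAt; join; fromℕ<)
import Data.Fin as Fin
import Data.Fin.Properties as Finₚ
open import Data.Fin.Induction using (<-wellFounded)
open import Data.Product using (_×_; Σ; ∃; _,_; proj₁; proj₂)
open import Data.Sum using (_⊎_; inj₁; inj₂; [_,_]′)
open import Data.Sum.Properties using (inj₂-injective; ≡-dec)
open import Data.List using (List; []; _∷_; _++_; [_]; length; map; filter; allFin; lookup)
open import Data.List.Properties using (length-++; length-map; length-tabulate)
open import Data.List.Membership.Propositional using (_∈_; _∉_)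
open import Data.List.Membership.Propositional.Properties
  using (∈-map⁺; ∈-++⁺ˡ; ∈-++⁺ʳ; ∈-filter⁺; ∈-allFin)
open import Data.List.Relation.Unary.Any using (here; there; index; any?)
open import Data.List.Relation.Unary.Any.Properties using (lookup-index)
open import Data.List.Relation.Unary.All using ([]; _∷_)
open import Data.List.Relation.Unary.AllPairs using ([]; _∷_)
open import Data.List.Relation.Unary.Linked using ([-]; _∷_)
open import Function using (_∘_)
open import Function.Definitions using (Injective)
open import Induction.WellFounded using (Acc; acc)
open import Relation.Binary.Definitions using (DecidableEquality; tri<; tri≈; tri>)
open import Relation.Binary.PropositionalEquality
  using (_≡_; _≢_; refl; sym; trans; cong; cong₂; subst; ≢-sym; module ≡-Reasoning)
open import Relation.Nullary using (yes; no; ¬_; contradiction; _×-dec_)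
open import Relation.Unary using (Pred; Decidable)
open import Relation.Unary.Properties using (∁?)
open import Defs

∃-∉ : ∀ {m} (F : List (Fin m)) → length F < m → ∃ λ s → s ∉ F
∃-∉ {m} F |F|<m with Finₚ.all? (λ s → any? (s ≟_) F)
... | no ¬all = Finₚ.¬∀⟶∃¬ m _ (λ s → any? (s ≟_) F) ¬all
... | yes all with Finₚ.pigeonhole |F|<m (λ s → index (all s))
...   | i , j , i<j , sameIndex = contradiction i≡j (Finₚ.<⇒≢ i<j)
  where
  i≡j = trans (lookup-index (all i)) (trans (cong (lookup F) sameIndex) (sym (lookup-index (all j))))

record AvoidingInjection {A : Set} {m : ℕ} (L : List A) (F : List (Fin m)) : Set where
  field
    embed     : A → Fin m
    avoids    : ∀ {x} → x ∈ L → embed x ∉ F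
    injective : ∀ {x y} → x ∈ L → y ∈ L → embed x ≡ embed y → x ≡ y

-- The bound is assumed only for nonempty L, since the relay groups below fit only then.
avoidingInjection : ∀ {A : Set} {m} → DecidableEquality A → Fin m →
  (L : List A) (F : List (Fin m)) → (∀ {x} → x ∈ L → length F + length L ≤ m) →
  AvoidingInjection L F
avoidingInjection _ d [] F _ = record { embed = λ _ → d ; avoids = λ () ; injective = λ () }
avoidingInjection {m = m} _≟ᴬ_ d (x ∷ L) F fits =
  record { embed = embed ; avoids = avoids ; injective = injective }
  where
  fitsˣ : length F + suc (length L) ≤ m
  fitsˣ = fits (here refl)

  fresh = ∃-∉ F (<-≤-trans (m<m+n (length F) (s≤s z≤n)) fitsˣ)
  s = proj₁ fresh

  module Rest = AvoidingInjection
    (avoidingInjection _≟ᴬ_ d L (s ∷ F) (λ _ → subst (_≤ m) (+-suc (length F) (length L)) fitsˣ))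

  embed : _ → Fin m
  embed y with y ≟ᴬ x
  ... | yes _ = s
  ... | no  _ = Rest.embed y

  avoids : ∀ {y} → y ∈ x ∷ L → embed y ∉ F
  avoids {y} y∈ with y ≟ᴬ x
  avoids _           | yes _ = proj₂ fresh
  avoids (here y≡x)  | no y≢x = contradiction y≡x y≢x
  avoids (there y∈L) | no _ = Rest.avoids y∈L ∘ there

  injective : ∀ {y z} → y ∈ x ∷ L → z ∈ x ∷ L → embed y ≡ embed z → y ≡ z
  injective {y} {z} _ _ _ with y ≟ᴬ x | z ≟ᴬ x
  injective _           _           _   | yes y≡x | yes z≡x = trans y≡x (sym z≡x)
  injective _           (here z≡x)  _   | _       | no z≢x  = contradiction z≡x z≢x
  injective (here y≡x)  _           _   | no y≢x  | _       = contradiction y≡x y≢x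
  injective _           (there z∈L) s≡z | yes _   | no _    = contradiction (here (sym s≡z)) (Rest.avoids z∈L)
  injective (there y∈L) _           y≡s | no _    | yes _   = contradiction (here y≡s) (Rest.avoids y∈L)
  injective (there y∈L) (there z∈L) eq  | no _    | no _    = Rest.injective y∈L z∈L eq

length-filter+filter-∁ : ∀ {A : Set} {ℓ} {P : Pred A ℓ} (P? : Decidable P) (xs : List A) →
  length (filter P? xs) + length (filter (∁? P?) xs) ≡ length xs
length-filter+filter-∁ P? [] = refl
length-filter+filter-∁ P? (x ∷ xs) with P? x
... | yes _ = cong suc (length-filter+filter-∁ P? xs)
... | no  _ = trans (+-suc _ _) (cong suc (length-filter+filter-∁ P? xs))

length-map-allFin : ∀ {A : Set} n (f : Fin n → A) → length (map f (allFin n)) ≡ n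
length-map-allFin n f = trans (length-map f (allFin n)) (length-tabulate _)

splitAt-injective : ∀ m {n} {i j : Fin (m + n)} → splitAt m i ≡ splitAt m j → i ≡ j
splitAt-injective m {n} {i} {j} eq =
  trans (sym (Finₚ.join-splitAt m n i)) (trans (cong (join m n) eq) (Finₚ.join-splitAt m n j))

module _ {Δ k} (T : TransversalDesign Δ k) where
  open TransversalDesign T

  blockThrough : ∀ {g h} → g ≢ h → Fin k → Fin k → Block k
  blockThrough g≢h x y = proj₁ (pairUnique _ _ g≢h x y)

  blockThrough-meets₁ : ∀ {g h} (g≢h : g ≢ h) x y → block (blockThrough g≢h x y) g ≡ x
  blockThrough-meets₁ g≢h x y = proj₁ (proj₁ (proj₂ (pairUnique _ _ g≢h x y)))

  blockThrough-meets₂ : ∀ {g h} (g≢h : g ≢ h) x y → block (blockThrough g≢h x y) h ≡ y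
  blockThrough-meets₂ g≢h x y = proj₂ (proj₁ (proj₂ (pairUnique _ _ g≢h x y)))

vertexGroup : ∀ {Δ k} → Fin Δ → Vertex Δ k → Fin Δ
vertexGroup _ (inj₁ x) = groupOf x
vertexGroup g (inj₂ _) = g

module Routing {Δ k} (T : TransversalDesign Δ k) (2≤k : 2 ≤ k) (Δ≤k : Δ ≤ k)
  {a b} (a+b≤Δ : a + b ≤ Δ) (tn : Fin a → Node Δ k) (tb : Fin b → Block k)
  (D₀ : Fin Δ) (tn∉D₀ : ∀ p → groupOf (tn p) ≢ D₀) where
  open TransversalDesign T

  Target : Set
  Target = Fin a ⊎ Fin b

  target : Target → Vertex Δ k
  target = [ (λ p → inj₁ (tn p)) , (λ j → inj₂ (tb j)) ]′

  anchor : Fin b → Fin k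
  anchor j = block (tb j) D₀

  Repeated : Fin b → Set
  Repeated j = ∃ λ i → i Fin.< j × anchor i ≡ anchor j

  repeated? : Decidable Repeated
  repeated? j = Finₚ.any? (λ i → (i Finₚ.<? j) ×-dec (anchor i ≟ anchor j))

  firstBlocks repeatedBlocks : List (Fin b)
  firstBlocks    = filter (∁? repeated?) (allFin b)
  repeatedBlocks = filter repeated? (allFin b)

  anchors : List (Fin k)
  anchors = map anchor firstBlocks

  anchor∈anchors : ∀ j → anchor j ∈ anchors
  anchor∈anchors j = go j (<-wellFounded j)
    where
    go : ∀ j → Acc Fin._<_ j → anchor j ∈ anchors
    go j (acc earlier) with repeated? j
    ... | no first = ∈-map⁺ anchor (∈-filter⁺ (∁? repeated?) (∈-allFin j) first)
    ... | yes (i , i<j , same) = subst (_∈ anchors) same (go i (earlier i<j))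

  anchor-injective-on-first : ∀ {i j} → ¬ Repeated i → ¬ Repeated j → anchor i ≡ anchor j → i ≡ j
  anchor-injective-on-first {i} {j} first-i first-j same with Finₚ.<-cmp i j
  ... | tri< i<j _ _ = contradiction (i , i<j , same) first-j
  ... | tri≈ _ i≡j _ = i≡j
  ... | tri> _ _ j<i = contradiction (j , j<i , sym same) first-i

  repeatedBlock∈ : ∀ {j} → Repeated j → j ∈ repeatedBlocks
  repeatedBlock∈ {j} = ∈-filter⁺ repeated? (∈-allFin j)

  length-blocks : length repeatedBlocks + length firstBlocks ≡ b
  length-blocks = trans (length-filter+filter-∁ repeated? (allFin b)) (length-tabulate _)

  -- Targets served by a fresh element of D₀: all target-nodes and the repeated target-blocks.
  detoured : List Target
  detoured = map inj₁ (allFin a) ++ map inj₂ repeatedBlocks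

  detoured∋node : ∀ p → inj₁ p ∈ detoured
  detoured∋node p = ∈-++⁺ˡ (∈-map⁺ inj₁ (∈-allFin p))

  detoured∋repeated : ∀ {j} → Repeated j → inj₂ j ∈ detoured
  detoured∋repeated rj = ∈-++⁺ʳ (map inj₁ (allFin a)) (∈-map⁺ inj₂ (repeatedBlock∈ rj))

  sources-fit : length anchors + length detoured ≤ k
  sources-fit = ≤-trans (≤-reflexive count) (≤-trans a+b≤Δ Δ≤k)
    where
    open ≡-Reasoning
    r = length repeatedBlocks
    f = length firstBlocks
    count : length anchors + length detoured ≡ a + b
    count = begin
      length anchors + length detoured
        ≡⟨ cong₂ _+_ (length-map anchor firstBlocks)
                     (trans (length-++ (map inj₁ (allFin a)))
                            (cong₂ _+_ (length-map-allFin a inj₁) (length-map inj₂ repeatedBlocks))) ⟩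
      f + (a + r)  ≡⟨ +-comm f (a + r) ⟩
      (a + r) + f  ≡⟨ +-assoc a r f ⟩
      a + (r + f)  ≡⟨ cong (a +_) length-blocks ⟩
      a + b        ∎

  open AvoidingInjection
    (avoidingInjection (≡-dec _≟_ _≟_) (fromℕ< 2≤k) detoured anchors (λ _ → sources-fit))
    renaming (embed to freshSource; avoids to freshSource∉anchors; injective to freshSource-injective)

  usedGroups : List (Fin Δ)
  usedGroups = D₀ ∷ map (groupOf ∘ tn) (allFin a)

  relayGroups-fit : ∀ {j} → j ∈ repeatedBlocks → length usedGroups + length repeatedBlocks ≤ Δ
  relayGroups-fit {j} _ = begin
    length usedGroups + r  ≡⟨ cong (λ n → suc n + r) (length-map-allFin a (groupOf ∘ tn)) ⟩
    suc (a + r)            ≡⟨ sym (+-suc a r) ⟩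
    a + suc r              ≤⟨ +-monoʳ-≤ a (m<m+n r someFirst) ⟩
    a + (r + f)            ≡⟨ cong (a +_) length-blocks ⟩
    a + b                  ≤⟨ a+b≤Δ ⟩
    Δ                      ∎
    where
    open ≤-Reasoning
    r = length repeatedBlocks
    f = length firstBlocks
    nonEmpty : ∀ {A : Set} {x : A} {xs} → x ∈ xs → 0 < length xs
    nonEmpty (here _)  = s≤s z≤n
    nonEmpty (there _) = s≤s z≤n
    someFirst : 0 < f
    someFirst = subst (0 <_) (length-map anchor firstBlocks) (nonEmpty (anchor∈anchors j))

  open AvoidingInjection (avoidingInjection _≟_ D₀ repeatedBlocks usedGroups relayGroups-fit)
    renaming (embed to relayGroup; avoids to relayGroup∉used; injective to relayGroup-injective)

  D₀≢relayGroup : ∀ {j} → Repeated j → D₀ ≢ relayGroup j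
  D₀≢relayGroup rj D₀≡ = relayGroup∉used (repeatedBlock∈ rj) (here (sym D₀≡))

  relayGroup≢tn : ∀ {j} → Repeated j → ∀ p → relayGroup j ≢ groupOf (tn p)
  relayGroup≢tn rj p same =
    relayGroup∉used (repeatedBlock∈ rj) (there (subst (_∈ _) (sym same) (∈-map⁺ _ (∈-allFin p))))

  relay : Fin b → Node Δ k
  relay j = relayGroup j , block (tb j) (relayGroup j)

  source : Target → Fin k
  source (inj₁ p) = freshSource (inj₁ p)
  source (inj₂ j) with repeated? j
  ... | yes _ = freshSource (inj₂ j)
  ... | no  _ = anchor j

  internal : Target → List (Vertex Δ k)
  internal (inj₁ p) = [ inj₂ (blockThrough T (≢-sym (tn∉D₀ p)) (freshSource (inj₁ p)) (proj₂ (tn p))) ]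
  internal (inj₂ j) with repeated? j
  ... | yes rj = inj₂ (blockThrough T (D₀≢relayGroup rj) (freshSource (inj₂ j)) (proj₂ (relay j)))
               ∷ [ inj₁ (relay j) ]
  ... | no  _  = []

  source-repeated : ∀ {j} → Repeated j → source (inj₂ j) ≡ freshSource (inj₂ j)
  source-repeated {j} rj with repeated? j
  ... | yes _     = refl
  ... | no  first = contradiction rj first

  source-first : ∀ {j} → ¬ Repeated j → source (inj₂ j) ≡ anchor j
  source-first {j} first with repeated? j
  ... | yes rj = contradiction rj first
  ... | no  _  = refl

  data SourceKind : Target → Set where
    fresh    : ∀ {u} → u ∈ detoured → source u ≡ freshSource u → SourceKind u
    anchored : ∀ {j} → ¬ Repeated j → source (inj₂ j) ≡ anchor j → SourceKind (inj₂ j)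

  sourceKind : ∀ u → SourceKind u
  sourceKind (inj₁ p) = fresh (detoured∋node p) refl
  sourceKind (inj₂ j) with repeated? j
  ... | yes rj    = fresh (detoured∋repeated rj) (source-repeated rj)
  ... | no  first = anchored first (source-first first)

  fresh≢anchor : ∀ {u} → u ∈ detoured → ∀ j → freshSource u ≢ anchor j
  fresh≢anchor u∈ j same = freshSource∉anchors u∈ (subst (_∈ anchors) (sym same) (anchor∈anchors j))

  source-injective : ∀ u v → source u ≡ source v → u ≡ v
  source-injective u v same with sourceKind u | sourceKind v
  ... | fresh u∈ su | fresh v∈ sv = freshSource-injective u∈ v∈ (trans (sym su) (trans same sv))
  ... | fresh u∈ su | anchored {j} _ sv = contradiction (trans (sym su) (trans same sv)) (fresh≢anchor u∈ j)
  ... | anchored {i} _ su | fresh v∈ sv = contradiction (trans (sym sv) (trans (sym same) su)) (fresh≢anchor v∈ i)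
  ... | anchored first-i su | anchored first-j sv =
    cong inj₂ (anchor-injective-on-first first-i first-j (trans (sym su) (trans same sv)))

  data Internal (u : Target) (v : Vertex Δ k) : Set where
    freshBlock : ∀ B → v ≡ inj₂ B → block B D₀ ≡ source u → source u ∉ anchors → Internal u v
    relayNode  : ∀ j → u ≡ inj₂ j → Repeated j → v ≡ inj₁ (relay j) → Internal u v

  freshBlock-repeated : ∀ {j} (rj : Repeated j) →
    Internal (inj₂ j) (inj₂ (blockThrough T (D₀≢relayGroup rj) (freshSource (inj₂ j)) (proj₂ (relay j))))
  freshBlock-repeated rj =
    freshBlock _ refl (trans (blockThrough-meets₁ T _ _ _) (sym (source-repeated rj)))
      (subst (_∉ anchors) (sym (source-repeated rj)) (freshSource∉anchors (detoured∋repeated rj)))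

  internal⇒Internal : ∀ u {v} → v ∈ internal u → Internal u v
  internal⇒Internal (inj₁ p) (here refl) =
    freshBlock _ refl (blockThrough-meets₁ T _ _ _) (freshSource∉anchors (detoured∋node p))
  internal⇒Internal (inj₂ j) v∈ with repeated? j
  internal⇒Internal (inj₂ j) (here refl)         | yes rj = freshBlock-repeated rj
  internal⇒Internal (inj₂ j) (there (here refl)) | yes rj = relayNode j refl rj refl

  Internal⇒≢source : ∀ {u v} → Internal u v → ∀ w → v ≢ inj₁ (D₀ , source w)
  Internal⇒≢source (freshBlock _ refl _ _) w ()
  Internal⇒≢source (relayNode _ _ rj refl) w same = D₀≢relayGroup rj (sym (cong (vertexGroup D₀) same))

  Internal⇒≢target : ∀ {u v} → Internal u v → ∀ w → v ≢ target w
  Internal⇒≢target (freshBlock B refl meets ∉anchors) (inj₂ j) same =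
    ∉anchors (subst (_∈ anchors) (trans (cong (λ B → block B D₀) (sym (inj₂-injective same))) meets)
                 (anchor∈anchors j))
  Internal⇒≢target (relayNode _ _ rj refl) (inj₁ p) same = relayGroup≢tn rj p (cong (vertexGroup D₀) same)

  Internal-unique : ∀ {u w v} → Internal u v → Internal w v → u ≡ w
  Internal-unique (freshBlock B refl meets _) (freshBlock _ refl meets′ _) =
    source-injective _ _ (trans (sym meets) meets′)
  Internal-unique (relayNode j refl rj refl) (relayNode j′ refl rj′ same) =
    cong inj₂ (relayGroup-injective (repeatedBlock∈ rj) (repeatedBlock∈ rj′) (cong (vertexGroup D₀) same))

  route : ∀ u → IsPath T (inj₁ (D₀ , source u)) (internal u) (target u)
  route (inj₁ p) =
    ((((λ ()) ∷ (λ same → tn∉D₀ p (sym (cong (vertexGroup D₀) same))) ∷ []) ∷ ((λ ()) ∷ []) ∷ [] ∷ []) ,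
     (blockThrough-meets₁ T _ _ _ ∷ blockThrough-meets₂ T _ _ _ ∷ [-]))
  route (inj₂ j) with repeated? j
  ... | yes rj =
    (((λ ()) ∷ (D₀≢relayGroup rj ∘ cong (vertexGroup D₀)) ∷ (λ ()) ∷ []) ∷
      ((λ ()) ∷ Internal⇒≢target (freshBlock-repeated rj) (inj₂ j) ∷ []) ∷ ((λ ()) ∷ []) ∷ [] ∷ []) ,
    (blockThrough-meets₁ T _ _ _ ∷ blockThrough-meets₂ T _ _ _ ∷ refl ∷ [-])
  ... | no _ = (((λ ()) ∷ []) ∷ [] ∷ []) , (refl ∷ [-])

  route-short : ∀ u → pathLength (internal u) ≤ 3
  route-short (inj₁ p) = s≤s (s≤s z≤n)
  route-short (inj₂ j) with repeated? j
  ... | yes _ = s≤s (s≤s (s≤s z≤n))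
  ... | no  _ = s≤s z≤n

  routes-disjoint : InternallyDisjoint (λ i → inj₁ (D₀ , source (splitAt a i))) (internal ∘ splitAt a)
                                       (targets tn tb)
  routes-disjoint i j v v∈ =
    Internal⇒≢source int (splitAt a j) , Internal⇒≢target int (splitAt a j) ,
    λ i≢j v∈′ → i≢j (splitAt-injective a (Internal-unique int (internal⇒Internal (splitAt a j) v∈′)))
    where int = internal⇒Internal (splitAt a i) v∈

theorem4 : (Δ k : ℕ) → 2 ≤ k → 2 ≤ Δ → Δ ≤ k →
    (T : TransversalDesign Δ k) →
    (a b : ℕ) → a + b ≤ Δ →
    (tn : Fin a → Node Δ k) → (tb : Fin b → Block k) →
    (D₀ : Fin Δ) → (∀ i → groupOf (tn i) ≢ D₀) →
    Σ (Fin (a + b) → Fin k) λ S →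
    Injective _≡_ _≡_ S ×
    Σ (Fin (a + b) → List (Vertex Δ k)) λ mids →
    (∀ i → IsPath T (inj₁ (D₀ , S i)) (mids i) (targets tn tb i)) ×
    (∀ i → pathLength (mids i) ≤ 3) ×
    InternallyDisjoint (λ i → inj₁ (D₀ , S i)) mids (targets tn tb)
theorem4 Δ k 2≤k _ Δ≤k T a b a+b≤Δ tn tb D₀ tn∉D₀ =
  source ∘ splitAt a ,
  (λ same → splitAt-injective a (source-injective _ _ same)) ,
  internal ∘ splitAt a ,
  route ∘ splitAt a ,
  route-short ∘ splitAt a ,
  routes-disjoint
  where open Routing T 2≤k Δ≤k a+b≤Δ tn tb D₀ tn∉D₀
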